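{- Let $\mathbb{M}\in\{\mathsf K,\mathsf D,\mathsf T,\mathsf{K4},\mathsf{S4}\}$. If the 2-sequent $\vdash A^{\alpha}$ is derivable in $2_{\mathbb M}$ (for some position $\alpha$), then $\vdash_{\mathbb M}A$ in the Hilbert-style presentation of $\mathbb M$.
   Context: Hilbert systems: for a set $Z$ of modal formulas (over $\neg,\wedge,\vee,\to,\Box,\Diamond$), $\mathrm{K}Z$ is the smallest set containing $Z$, all instances of $A\to(B\to A)$, $(A\to(B\to C))\to((A\to B)\to(A\to C))$, $(\neg B\to\neg A)\to((\neg B\to A)\to B)$, $\Box(A\to B)\to(\Box A\to\Box B)$, closed under modus ponens and necessitation. $\mathsf K=\mathrm K\varnothing$, $\mathsf D=\mathrm K\{\Box A\to\Diamond A\}$, $\mathsf T=\mathrm K\{\Box A\to A\}$, $\mathsf{K4}=\mathrm K\{\Box A\to\Box\Box A\}$, $\mathsf{S4}=\mathrm K\{\Box A\to A,\Box A\to\Box\Box A\}$ (all instances); $\vdash_{\mathbb M}A$ means $A\in\mathbb M$. Fix a countably infinite set of tokens; a position is a finite (possibly empty) sequence of tokens, $\circ$ concatenation, $\alpha\circ x=\alpha\circ\langle x\rangle$, $\beta\preceq\alpha$ means $\beta$ is a prefix of $\alpha$. A p-formula is $A^\alpha$; a 2-sequent is $\Gamma\vdash\Delta$ with $\Gamma,\Delta$ finite (possibly empty) sequences of p-formulas; $I(\Gamma)=\{\beta:\exists A^\alpha\in\Gamma,\ \beta\preceq\alpha\}$. Calculus $2_{\mathsf{S4}}$: Axiom $A^\alpha\vdash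 A^\alpha$; Cut: from $\Gamma_1\vdash A^\alpha,\Delta_1$ and $\Gamma_2,A^\alpha\vdash\Delta_2$ infer $\Gamma_1,\Gamma_2\vdash\Delta_1,\Delta_2$; weakening, contraction, exchange; classical propositional sequent rules for $\neg,\wedge,\vee,\to$ with all active p-formulas at the same position; modal rules: ($\Box\vdash$) from $\Gamma,A^{\alpha\circ\beta}\vdash\Delta$ infer $\Gamma,(\Box A)^\alpha\vdash\Delta$; ($\vdash\Box$) from $\Gamma\vdash A^{\alpha\circ x},\Delta$ infer $\Gamma\vdash(\Box A)^\alpha,\Delta$; ($\Diamond\vdash$) from $\Gamma,A^{\alpha\circ x}\vdash\Delta$ infer $\Gamma,(\Diamond A)^\alpha\vdash\Delta$; ($\vdash\Diamond$) from $\Gamma\vdash A^{\alpha\circ\beta},\Delta$ infer $\Gamma\vdash(\Diamond A)^\alpha,\Delta$; $\beta$ a position, $x$ a token, and in $\vdash\Box,\Diamond\vdash$, $\alpha\circ x\notin I(\Gamma,\Delta)$. $2_{\mathsf T},2_{\mathsf D},2_{\mathsf{K4}},2_{\mathsf K}$ add constraints on $\Box\vdash,\vdash\Diamond$: $2_{\mathsf T}$: $\beta$ empty or a single token; $2_{\mathsf D}$: $\beta$ a single token; $2_{\mathsf{K4}}$: $\beta$ nonempty and $\Gamma$ or $\Delta$ contains some $B^{\alpha\circ\beta\circ\eta}$; $2_{\mathsf K}$: $\beta$ a single token and $\Gamma$ or $\Delta$ contains some $B^{\alpha\circ\beta\circ\eta}$. In $2_{\mathsf K},2_{\mathsf{K4}}$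 Cut requires $\alpha\in I(\Gamma_1,\Delta_1)$ or $\alpha\in I(\Gamma_2,\Delta_2)$. -}

module Defs where

open import Data.Nat using (ℕ)
open import Data.List using (List; []; _∷_; _++_; length)
open import Data.Product using (Σ; ∃; _×_; _,_)
open import Data.Sum using (_⊎_)
open import Data.Unit using (⊤)
open import Relation.Binary.PropositionalEquality using (_≡_)
open import Relation.Nullary using (¬_)
open import Data.List.Membership.Propositional using (_∈_)

infixr 5 _⇒_
data Formula : Set where
  var : ℕ → Formula
  ~_  : Formula → Formula
  _⇒_ : Formula → Formula → Formula
  □_  : Formula → Formula

_∧_ : Formula → Formula → Formula
A ∧ B = ~ (A ⇒ ~ B)

_∨_ : Formula → Formula → Formula
A ∨ B = (~ A) ⇒ B

◇_ : Formula → Formula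
◇ A = ~ (□ (~ A))

data Logic : Set where
  K D T K4 S4 : Logic

data ExtraAx : Logic → Formula → Set where
  axD  : ∀ A → ExtraAx D (□ A ⇒ ◇ A)
  axT  : ∀ A → ExtraAx T (□ A ⇒ A)
  ax4  : ∀ A → ExtraAx K4 (□ A ⇒ □ (□ A))
  axS4T : ∀ A → ExtraAx S4 (□ A ⇒ A)
  axS44 : ∀ A → ExtraAx S4 (□ A ⇒ □ (□ A))

data Hilbert (M : Logic) : Formula → Set where
  extra : ∀ {A} → ExtraAx M A → Hilbert M A
  ax1 : ∀ A B → Hilbert M (A ⇒ (B ⇒ A))
  ax2 : ∀ A B C → Hilbert M ((A ⇒ (B ⇒ C)) ⇒ ((A ⇒ B) ⇒ (A ⇒ C)))
  ax3 : ∀ A B → Hilbert M ((~ B ⇒ ~ A) ⇒ ((~ B ⇒ A) ⇒ B))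
  axK : ∀ A B → Hilbert M (□ (A ⇒ B) ⇒ (□ A ⇒ □ B))
  mp  : ∀ {A B} → Hilbert M (A ⇒ B) → Hilbert M A → Hilbert M B
  nec : ∀ {A} → Hilbert M A → Hilbert M (□ A)

Token : Set
Token = ℕ

Position : Set
Position = List Token

_⪯_ : Position → Position → Set
β ⪯ α = ∃ λ γ → β ++ γ ≡ α

record PFormula : Set where
  constructor _^_
  field
    formula  : Formula
    position : Position

Seq : Set
Seq = List PFormula

_∈I_ : Position → Seq → Set
β ∈I Γ = ∃ λ A → ∃ λ α → (A ^ α) ∈ Γ × β ⪯ α

Occurs : Position → Seq → Seq → Set
Occurs γ Γ Δ = ∃ λ B → ∃ λ η → ((B ^ (γ ++ η)) ∈ Γ) ⊎ ((B ^ (γ ++ η)) ∈ Δ)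

BoxCond : Logic → Position → Position → Seq → Seq → Set
BoxCond S4 α β Γ Δ = ⊤
BoxCond T  α β Γ Δ = (β ≡ []) ⊎ (∃ λ x → β ≡ x ∷ [])
BoxCond D  α β Γ Δ = ∃ λ x → β ≡ x ∷ []
BoxCond K4 α β Γ Δ = (¬ (β ≡ [])) × Occurs (α ++ β) Γ Δ
BoxCond K  α β Γ Δ = (∃ λ x → β ≡ x ∷ []) × Occurs (α ++ β) Γ Δ

CutCond : Logic → Position → Seq → Seq → Seq → Seq → Set
CutCond K  α Γ₁ Δ₁ Γ₂ Δ₂ = (α ∈I (Γ₁ ++ Δ₁)) ⊎ (α ∈I (Γ₂ ++ Δ₂))
CutCond K4 α Γ₁ Δ₁ Γ₂ Δ₂ = (α ∈I (Γ₁ ++ Δ₁)) ⊎ (α ∈I (Γ₂ ++ Δ₂))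
CutCond D  α Γ₁ Δ₁ Γ₂ Δ₂ = ⊤
CutCond T  α Γ₁ Δ₁ Γ₂ Δ₂ = ⊤
CutCond S4 α Γ₁ Δ₁ Γ₂ Δ₂ = ⊤

infix 3 _⊩_⊢_
data _⊩_⊢_ (M : Logic) : Seq → Seq → Set where
  axiom : ∀ {A α} → M ⊩ (A ^ α) ∷ [] ⊢ (A ^ α) ∷ []
  cut   : ∀ {Γ₁ Δ₁ Γ₂ Δ₂ A α} → CutCond M α Γ₁ Δ₁ Γ₂ Δ₂ →
          M ⊩ Γ₁ ⊢ (A ^ α) ∷ Δ₁ → M ⊩ (A ^ α) ∷ Γ₂ ⊢ Δ₂ →
          M ⊩ Γ₁ ++ Γ₂ ⊢ Δ₁ ++ Δ₂
  wkL  : ∀ {Γ Δ P} → M ⊩ Γ ⊢ Δ → M ⊩ P ∷ Γ ⊢ Δ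
  wkR  : ∀ {Γ Δ P} → M ⊩ Γ ⊢ Δ → M ⊩ Γ ⊢ P ∷ Δ
  ctrL : ∀ {Γ Δ P} → M ⊩ P ∷ P ∷ Γ ⊢ Δ → M ⊩ P ∷ Γ ⊢ Δ
  ctrR : ∀ {Γ Δ P} → M ⊩ Γ ⊢ P ∷ P ∷ Δ → M ⊩ Γ ⊢ P ∷ Δ
  exL  : ∀ {Γ₁ Γ₂ Δ P Q} → M ⊩ Γ₁ ++ P ∷ Q ∷ Γ₂ ⊢ Δ → M ⊩ Γ₁ ++ Q ∷ P ∷ Γ₂ ⊢ Δ
  exR  : ∀ {Γ Δ₁ Δ₂ P Q} → M ⊩ Γ ⊢ Δ₁ ++ P ∷ Q ∷ Δ₂ → M ⊩ Γ ⊢ Δ₁ ++ Q ∷ P ∷ Δ₂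
  ¬L   : ∀ {Γ Δ A α} → M ⊩ Γ ⊢ (A ^ α) ∷ Δ → M ⊩ ((~ A) ^ α) ∷ Γ ⊢ Δ
  ¬R   : ∀ {Γ Δ A α} → M ⊩ (A ^ α) ∷ Γ ⊢ Δ → M ⊩ Γ ⊢ ((~ A) ^ α) ∷ Δ
  ∧L₁  : ∀ {Γ Δ A B α} → M ⊩ (A ^ α) ∷ Γ ⊢ Δ → M ⊩ ((A ∧ B) ^ α) ∷ Γ ⊢ Δ
  ∧L₂  : ∀ {Γ Δ A B α} → M ⊩ (B ^ α) ∷ Γ ⊢ Δ → M ⊩ ((A ∧ B) ^ α) ∷ Γ ⊢ Δ
  ∧R   : ∀ {Γ Δ A B α} → M ⊩ Γ ⊢ (A ^ α) ∷ Δ → M ⊩ Γ ⊢ (B ^ α) ∷ Δ →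
         M ⊩ Γ ⊢ ((A ∧ B) ^ α) ∷ Δ
  ∨L   : ∀ {Γ Δ A B α} → M ⊩ (A ^ α) ∷ Γ ⊢ Δ → M ⊩ (B ^ α) ∷ Γ ⊢ Δ →
         M ⊩ ((A ∨ B) ^ α) ∷ Γ ⊢ Δ
  ∨R₁  : ∀ {Γ Δ A B α} → M ⊩ Γ ⊢ (A ^ α) ∷ Δ → M ⊩ Γ ⊢ ((A ∨ B) ^ α) ∷ Δ
  ∨R₂  : ∀ {Γ Δ A B α} → M ⊩ Γ ⊢ (B ^ α) ∷ Δ → M ⊩ Γ ⊢ ((A ∨ B) ^ α) ∷ Δ
  ⇒L   : ∀ {Γ Δ A B α} → M ⊩ Γ ⊢ (A ^ α) ∷ Δ → M ⊩ (B ^ α) ∷ Γ ⊢ Δ →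
         M ⊩ ((A ⇒ B) ^ α) ∷ Γ ⊢ Δ
  ⇒R   : ∀ {Γ Δ A B α} → M ⊩ (A ^ α) ∷ Γ ⊢ (B ^ α) ∷ Δ →
         M ⊩ Γ ⊢ ((A ⇒ B) ^ α) ∷ Δ
  □L   : ∀ {Γ Δ A α β} → BoxCond M α β Γ Δ →
         M ⊩ (A ^ (α ++ β)) ∷ Γ ⊢ Δ → M ⊩ ((□ A) ^ α) ∷ Γ ⊢ Δ
  □R   : ∀ {Γ Δ A α x} → ¬ ((α ++ x ∷ []) ∈I (Γ ++ Δ)) →
         M ⊩ Γ ⊢ (A ^ (α ++ x ∷ [])) ∷ Δ → M ⊩ Γ ⊢ ((□ A) ^ α) ∷ Δ
  ◇L   : ∀ {Γ Δ A α x} → ¬ ((α ++ x ∷ []) ∈I (Γ ++ Δ)) →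
         M ⊩ (A ^ (α ++ x ∷ [])) ∷ Γ ⊢ Δ → M ⊩ ((◇ A) ^ α) ∷ Γ ⊢ Δ
  ◇R   : ∀ {Γ Δ A α β} → BoxCond M α β Γ Δ →
         M ⊩ Γ ⊢ (A ^ (α ++ β)) ∷ Δ → M ⊩ Γ ⊢ ((◇ A) ^ α) ∷ Δ

module Submission where

-- A labelling w assigns a formula to every position;
-- it is good for Γ ⊢ Δ when, provably in M, w α implies A for each A^α
-- in Γ, implies ¬A for each A^α in Δ, and every edge γ → γ∘x of the tree
-- I(Γ,Δ) is ◇-accessible (w γ ⇒ ◇ w(γ∘x)).  A sequent is valid when every
-- good labelling is refuted at the root (⊢ ¬ w[]).
--
-- Each rule of
-- 2_M preserves validity, so derivable sequents are valid.  For ⊢ A^α the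
-- labelling forcing ¬A at α is good, and its refutation
-- ⊢ ¬(⊤ ∧ ◇(⊤ ∧ … ◇(⊤ ∧ ¬A))) yields ⊢ A because □B/B is admissible in M.

open import Defs
open import Data.Nat using () renaming (_≟_ to _≟ₙ_)
open import Data.List using (List; []; _∷_; _++_)
open import Data.List.Properties using (++-assoc; ++-identityʳ; ∷-injectiveˡ; ∷-injectiveʳ)
open import Data.List.Membership.Propositional using (_∈_)
open import Data.List.Membership.Propositional.Properties using (∈-++⁺ˡ; ∈-++⁺ʳ; ∈-++⁻)
open import Data.List.Relation.Unary.Any using (here; there)
open import Data.List.Relation.Binary.Subset.Propositional using (_⊆_)
open import Data.List.Relation.Binary.Subset.Propositional.Properties
  using (⊆-refl; ⊆-reflexive-↭; ∈-∷⁺ʳ; xs⊆xs++ys; xs⊆ys++xs; ++⁺)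
open import Data.List.Relation.Binary.Permutation.Propositional using (swap; ↭-refl)
open import Data.List.Relation.Binary.Permutation.Propositional.Properties
  using () renaming (++⁺ˡ to ↭-++⁺ˡ)
open import Data.Product using (_×_; _,_; proj₁; proj₂)
open import Data.Sum using (_⊎_; inj₁; inj₂)
open import Data.Empty using (⊥-elim)
open import Relation.Nullary using (Dec; yes; no; ¬_)
open import Relation.Binary.PropositionalEquality using (_≡_; refl; sym; trans; cong; subst)

-- A fixed theorem of every logic, playing the role of "true".
Top : Formula
Top = var 0 ⇒ var 0

-- Derivations in M from a list of hypotheses; with the deduction theorem
-- they let Hilbert proofs be written in natural-deduction style.
data Der (M : Logic) (Γ : List Formula) : Formula → Set where
  hyp : ∀ {A} → A ∈ Γ → Der M Γ A
  thm : ∀ {A} → Hilbert M A → Der M Γ A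
  _·_ : ∀ {A B} → Der M Γ (A ⇒ B) → Der M Γ A → Der M Γ B

infixl 4 _·_

module _ {M : Logic} where

  ⇒-refl : ∀ A → Hilbert M (A ⇒ A)
  ⇒-refl A = mp (mp (ax2 A (A ⇒ A) A) (ax1 A (A ⇒ A))) (ax1 A A)

  deduction : ∀ {Γ A B} → Der M (A ∷ Γ) B → Der M Γ (A ⇒ B)
  deduction (hyp (here refl)) = thm (⇒-refl _)
  deduction (hyp (there m))   = thm (ax1 _ _) · hyp m
  deduction (thm h)           = thm (ax1 _ _) · thm h
  deduction (f · g)           = thm (ax2 _ _ _) · deduction f · deduction g

  closed : ∀ {A} → Der M [] A → Hilbert M A
  closed (hyp ())
  closed (thm h) = h
  closed (f · g) = mp (closed f) (closed g)

  weaken : ∀ {Γ A B} → Der M Γ A → Der M (B ∷ Γ) A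
  weaken (hyp m) = hyp (there m)
  weaken (thm h) = thm h
  weaken (f · g) = weaken f · weaken g

  v0 : ∀ {Γ A} → Der M (A ∷ Γ) A
  v0 = hyp (here refl)

  v1 : ∀ {Γ A B} → Der M (B ∷ A ∷ Γ) A
  v1 = hyp (there (here refl))

  v2 : ∀ {Γ A B C} → Der M (C ∷ B ∷ A ∷ Γ) A
  v2 = hyp (there (there (here refl)))

  dne : ∀ {Γ A} → Der M Γ (~ ~ A) → Der M Γ A
  dne {A = A} p = thm (ax3 (~ A) A) · deduction (weaken p) · thm (⇒-refl _)

  explode : ∀ {Γ A B} → Der M Γ A → Der M Γ (~ A) → Der M Γ B
  explode {A = A} {B} a na = thm (ax3 A B) · deduction (weaken na) · deduction (weaken a)

  ¬-intro : ∀ {Γ A B} → Der M (A ∷ Γ) B → Der M (A ∷ Γ) (~ B) → Der M Γ (~ A)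
  ¬-intro {A = A} {B} p q =
    thm (ax3 B (~ A)) · deduction (weaken (deduction q) · dne v0)
                      · deduction (weaken (deduction p) · dne v0)

  by-contradiction : ∀ {Γ A B} → Der M (~ A ∷ Γ) B → Der M (~ A ∷ Γ) (~ B) → Der M Γ A
  by-contradiction p q = dne (¬-intro p q)

  contrapose : ∀ {Γ A B} → Der M Γ (A ⇒ B) → Der M Γ (~ B ⇒ ~ A)
  contrapose f = deduction (¬-intro (weaken (weaken f) · v0) v1)

  dni : ∀ {Γ A} → Der M Γ A → Der M Γ (~ ~ A)
  dni a = ¬-intro (weaken a) v0

  ∧-intro : ∀ {Γ A B} → Der M Γ A → Der M Γ B → Der M Γ (A ∧ B)
  ∧-intro a b = ¬-intro (weaken b) (v0 · weaken a)

  ∧-elimˡ : ∀ {Γ A B} → Der M Γ (A ∧ B) → Der M Γ A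
  ∧-elimˡ p = by-contradiction (deduction (explode v0 v1)) (weaken p)

  ∧-elimʳ : ∀ {Γ A B} → Der M Γ (A ∧ B) → Der M Γ B
  ∧-elimʳ p = by-contradiction (deduction v1) (weaken p)

  ∨-introˡ : ∀ {Γ A B} → Der M Γ A → Der M Γ (A ∨ B)
  ∨-introˡ a = deduction (explode (weaken a) v0)

  ∨-introʳ : ∀ {Γ A B} → Der M Γ B → Der M Γ (A ∨ B)
  ∨-introʳ b = deduction (weaken b)

  ∨-elim : ∀ {Γ A B C} → Der M Γ (A ∨ B) → Der M (A ∷ Γ) C → Der M (B ∷ Γ) C → Der M Γ C
  ∨-elim {A = A} {C = C} p l r =
    thm (ax3 (~ A) C) · contrapose (deduction (weaken (deduction r) · (weaken p · v0)))
                      · contrapose (deduction l)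

  _∘ₕ_ : ∀ {A B C} → Hilbert M (B ⇒ C) → Hilbert M (A ⇒ B) → Hilbert M (A ⇒ C)
  g ∘ₕ f = closed (deduction (thm g · (thm f · v0)))

  ⟨_,_⟩ₕ : ∀ {X A B} → Hilbert M (X ⇒ A) → Hilbert M (X ⇒ B) → Hilbert M (X ⇒ (A ∧ B))
  ⟨ f , g ⟩ₕ = closed (deduction (∧-intro (thm f · v0) (thm g · v0)))

  fstₕ : ∀ {A B} → Hilbert M ((A ∧ B) ⇒ A)
  fstₕ = closed (deduction (∧-elimˡ v0))

  sndₕ : ∀ {A B} → Hilbert M ((A ∧ B) ⇒ B)
  sndₕ = closed (deduction (∧-elimʳ v0))

  dneₕ : ∀ {A} → Hilbert M (~ ~ A ⇒ A)
  dneₕ = closed (deduction (dne v0))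

  tollens : ∀ {X Y} → Hilbert M (X ⇒ Y) → Hilbert M (~ Y) → Hilbert M (~ X)
  tollens f h = closed (¬-intro (thm f · v0) (thm h))

  tollens-∨ : ∀ {X Y Z} → Hilbert M (X ⇒ (Y ∨ Z)) → Hilbert M (~ Y) → Hilbert M (~ Z) →
              Hilbert M (~ X)
  tollens-∨ f hy hz = closed (¬-intro (thm f · v0 · thm hy) (thm hz))

  ¬∧-split : ∀ {A B} → Hilbert M (~ (A ∧ B) ⇒ ((~ A) ∨ (~ B)))
  ¬∧-split = closed (deduction (deduction (dne v1 · dne v0)))

  ⇒-split : ∀ {A B} → Hilbert M ((A ⇒ B) ⇒ ((~ A) ∨ B))
  ⇒-split = closed (deduction (deduction (v1 · dne v0)))

  ¬∨-left : ∀ {A B} → Hilbert M (~ (A ∨ B) ⇒ ~ A)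
  ¬∨-left = closed (deduction (¬-intro (deduction (explode v1 v0)) v1))

  ¬∨-right : ∀ {A B} → Hilbert M (~ (A ∨ B) ⇒ ~ B)
  ¬∨-right = closed (deduction (¬-intro (deduction v1) v1))

  ¬⇒-ant : ∀ {A B} → Hilbert M (~ (A ⇒ B) ⇒ A)
  ¬⇒-ant = closed (deduction (by-contradiction (deduction (explode v0 v1)) v1))

  ¬⇒-con : ∀ {A B} → Hilbert M (~ (A ⇒ B) ⇒ ~ B)
  ¬⇒-con = closed (deduction (¬-intro (deduction v1) v1))

  excluded-middle : ∀ {X A} → Hilbert M (X ⇒ ((~ A) ∨ A))
  excluded-middle = closed (deduction (deduction (dne v0)))

  □-mono : ∀ {A B} → Hilbert M (A ⇒ B) → Hilbert M (□ A ⇒ □ B)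
  □-mono {A} {B} h = mp (axK A B) (nec h)

  ◇-mono : ∀ {A B} → Hilbert M (A ⇒ B) → Hilbert M (◇ A ⇒ ◇ B)
  ◇-mono h = closed (contrapose (thm (□-mono (closed (contrapose (thm h))))))

  ¬□-◇¬ : ∀ {A} → Hilbert M (~ (□ A) ⇒ ◇ (~ A))
  ¬□-◇¬ = closed (contrapose (thm (□-mono dneₕ)))

  □-∧ : ∀ {A B} → Hilbert M (□ A ⇒ (□ B ⇒ □ (A ∧ B)))
  □-∧ {A} {B} = closed (deduction (deduction
    (thm (axK B (A ∧ B)) · (thm (axK A (B ⇒ (A ∧ B)))
       · thm (nec (closed (deduction (deduction (∧-intro v1 v0))))) · v1) · v0)))

  ◇-∨ : ∀ {A B} → Hilbert M (◇ (A ∨ B) ⇒ ((◇ A) ∨ (◇ B)))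
  ◇-∨ {A} {B} = closed (deduction (deduction (¬-intro
    (thm (□-mono (closed (deduction (¬-intro (v0 · ∧-elimˡ v1) (∧-elimʳ v1)))))
      · (thm □-∧ · dne v1 · v0))
    v2)))

  □-◇ : ∀ {C X} → Hilbert M (□ C ⇒ (◇ X ⇒ ◇ (X ∧ C)))
  □-◇ {C} {X} = closed (deduction (deduction (¬-intro
    (thm (axK (~ (X ∧ C)) (~ X)) · (thm (axK C (~ (X ∧ C) ⇒ ~ X))
       · thm (nec (closed (deduction (deduction (¬-intro (∧-intro v0 v2) v1))))) · v2) · v0)
    v1)))

-- The logics without the T axiom prove each outermost □B together with B:
-- replacing every outermost □B by B ∧ □B preserves theoremhood.
data Irreflexive : Logic → Set where
  irrK : Irreflexive K
  irrD : Irreflexive D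
  irrK4 : Irreflexive K4

reflectOuter : Formula → Formula
reflectOuter (var n) = var n
reflectOuter (~ A)   = ~ reflectOuter A
reflectOuter (A ⇒ B) = reflectOuter A ⇒ reflectOuter B
reflectOuter (□ A)   = A ∧ (□ A)

reflectOuter-sound : ∀ {M A} → Irreflexive M → Hilbert M A → Hilbert M (reflectOuter A)
reflectOuter-sound irrD (extra (axD A)) =
  closed (deduction (¬-intro (∧-elimˡ v1) (∧-elimˡ v0)))
reflectOuter-sound irrK4 (extra (ax4 A)) =
  closed (deduction (∧-intro (∧-elimʳ v0) (thm (extra (ax4 A)) · ∧-elimʳ v0)))
reflectOuter-sound i (ax1 A B)   = ax1 (reflectOuter A) (reflectOuter B)
reflectOuter-sound i (ax2 A B C) = ax2 (reflectOuter A) (reflectOuter B) (reflectOuter C)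
reflectOuter-sound i (ax3 A B)   = ax3 (reflectOuter A) (reflectOuter B)
reflectOuter-sound i (axK A B)   =
  closed (deduction (deduction (∧-intro (∧-elimˡ v1 · ∧-elimˡ v0) (thm (axK A B) · ∧-elimʳ v1 · ∧-elimʳ v0))))
reflectOuter-sound i (mp d e)    = mp (reflectOuter-sound i d) (reflectOuter-sound i e)
reflectOuter-sound i (nec d)     = closed (∧-intro (thm d) (thm (nec d)))

unbox : ∀ M {A} → Hilbert M (□ A) → Hilbert M A
unbox K  h = closed (∧-elimˡ (thm (reflectOuter-sound irrK h)))
unbox D  h = closed (∧-elimˡ (thm (reflectOuter-sound irrD h)))
unbox K4 h = closed (∧-elimˡ (thm (reflectOuter-sound irrK4 h)))
unbox T  {A} h = mp (extra (axT A)) h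
unbox S4 {A} h = mp (extra (axS4T A)) h

data Serial : Logic → Set where
  serD : Serial D
  serT : Serial T
  serS4 : Serial S4

◇-Top : ∀ {M} → Serial M → Hilbert M (◇ Top)
◇-Top serD  = mp (extra (axD Top)) (nec (⇒-refl _))
◇-Top serT  = closed (¬-intro (thm (⇒-refl _)) (thm (extra (axT (~ Top))) · v0))
◇-Top serS4 = closed (¬-intro (thm (⇒-refl _)) (thm (extra (axS4T (~ Top))) · v0))

⪯-refl : ∀ α → α ⪯ α
⪯-refl α = [] , ++-identityʳ α

⪯-trans : ∀ {β α γ} → β ⪯ α → α ⪯ γ → β ⪯ γ
⪯-trans {β} (δ , e₁) (ε , e₂) = δ ++ ε , trans (sym (++-assoc β δ ε)) (trans (cong (_++ ε) e₁) e₂)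

⪯-cons : ∀ {x β α} → β ⪯ α → (x ∷ β) ⪯ (x ∷ α)
⪯-cons (δ , e) = δ , cong (_ ∷_) e

⪯-uncons : ∀ {x y β α} → (x ∷ β) ⪯ (y ∷ α) → (x ≡ y) × (β ⪯ α)
⪯-uncons (δ , e) = ∷-injectiveˡ e , (δ , ∷-injectiveʳ e)

⪯-++ : ∀ α {β γ} → β ⪯ γ → (α ++ β) ⪯ (α ++ γ)
⪯-++ α {β} (δ , e) = δ , trans (++-assoc α β δ) (cong (α ++_) e)

snoc-⋠-[] : ∀ γ x → ¬ ((γ ++ x ∷ []) ⪯ [])
snoc-⋠-[] []      x (δ , ())
snoc-⋠-[] (_ ∷ γ) x (δ , ())

snoc-⋠-self : ∀ α x → ¬ ((α ++ x ∷ []) ⪯ α)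
snoc-⋠-self []      x p = snoc-⋠-[] [] x p
snoc-⋠-self (_ ∷ α) x p = snoc-⋠-self α x (proj₂ (⪯-uncons p))

_⪯?_ : (β α : Position) → Dec (β ⪯ α)
[]      ⪯? α = yes (α , refl)
(x ∷ β) ⪯? [] = no (λ { (γ , ()) })
(x ∷ β) ⪯? (y ∷ α) with x ≟ₙ y | β ⪯? α
... | yes refl | yes p = yes (⪯-cons p)
... | yes refl | no ¬p = no (λ q → ¬p (proj₂ (⪯-uncons q)))
... | no ¬e    | _     = no (λ q → ¬e (proj₁ (⪯-uncons q)))

_∈I?_ : (δ : Position) (S : Seq) → Dec (δ ∈I S)
δ ∈I? [] = no (λ { (A , α , () , _) })
δ ∈I? ((A ^ α) ∷ S) with δ ⪯? α | δ ∈I? S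
... | yes p | _                    = yes (A , α , here refl , p)
... | no _  | yes (B , β , m , p)  = yes (B , β , there m , p)
... | no ¬p | no ¬q = no λ { (B , β , here refl , p) → ¬p p
                           ; (B , β , there m , p)   → ¬q (B , β , m , p) }

∈I-⪯ : ∀ {β α S} → β ⪯ α → α ∈I S → β ∈I S
∈I-⪯ p (A , γ , m , q) = A , γ , m , ⪯-trans p q

∈I-mono : ∀ {S S' δ} → S ⊆ S' → δ ∈I S → δ ∈I S'
∈I-mono f (A , γ , m , q) = A , γ , f m , q

∈I-pos : ∀ {A α S} → (A ^ α) ∈ S → α ∈I S
∈I-pos {A} {α} m = A , α , m , ⪯-refl α

fresh-insert : ∀ Γ {Δ B α x} → ¬ ((α ++ x ∷ []) ∈I (Γ ++ Δ)) →
               ¬ ((α ++ x ∷ []) ∈I (Γ ++ (B ^ α) ∷ Δ))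
fresh-insert Γ {α = α} {x} fr (B , β , m , q) with ∈-++⁻ Γ m
... | inj₁ m'         = fr (B , β , ∈-++⁺ˡ m' , q)
... | inj₂ (here refl) = snoc-⋠-self α x q
... | inj₂ (there m') = fr (B , β , ∈-++⁺ʳ Γ m' , q)

Labelling : Set
Labelling = Position → Formula

subtree : Labelling → Position → Labelling
subtree w α δ = w (α ++ δ)

child : Labelling → Token → Labelling
child w x = subtree w (x ∷ [])

AccAlong : Logic → Labelling → Position → Set
AccAlong M w α = ∀ {γ x} → (γ ++ x ∷ []) ⪯ α → Hilbert M (w γ ⇒ ◇ w (γ ++ x ∷ []))

module _ {M : Logic} where

  subtree-root : ∀ (w : Labelling) α → Hilbert M (w α ⇒ subtree w α [])
  subtree-root w α = subst (λ z → Hilbert M (w α ⇒ w z)) (sym (++-identityʳ α)) (⇒-refl _)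

  acc-prefix : ∀ {w α β} → β ⪯ α → AccAlong M w α → AccAlong M w β
  acc-prefix q a p = a (⪯-trans p q)

  acc-subtree : ∀ {w} α {β} → AccAlong M w (α ++ β) → AccAlong M (subtree w α) β
  acc-subtree {w} α {β} a {γ} {x} p =
    subst (λ z → Hilbert M (w (α ++ γ) ⇒ ◇ w z)) (++-assoc α γ (x ∷ []))
          (a (subst (_⪯ (α ++ β)) (sym (++-assoc α γ (x ∷ []))) (⪯-++ α p)))

  acc-head : ∀ {w x α} → AccAlong M w (x ∷ α) → Hilbert M (w [] ⇒ ◇ w (x ∷ []))
  acc-head {α = α} a = a (α , refl)

  refute-root : ∀ w α → AccAlong M w α → Hilbert M (~ w α) → Hilbert M (~ w [])
  refute-root w []      a h = h
  refute-root w (x ∷ α) a h =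
    closed (¬-intro (thm (acc-head a) · v0)
                    (dni (thm (nec (refute-root (child w x) α (acc-subtree (x ∷ []) a) h)))))

-- force w α φ strengthens w so that φ holds at α and, at every proper
-- prefix of α, the next world on the path to α is required by a ◇.
force : Labelling → Position → Formula → Labelling
force w []      φ []      = w [] ∧ φ
force w []      φ (y ∷ δ) = w (y ∷ δ)
force w (x ∷ α) φ []      = w [] ∧ (◇ (force (child w x) α φ []))
force w (x ∷ α) φ (y ∷ δ) with x ≟ₙ y
... | yes _ = force (child w x) α φ δ
... | no _  = w (y ∷ δ)

module _ {M : Logic} where

  force-stronger : ∀ w α φ δ → Hilbert M (force w α φ δ ⇒ w δ)
  force-stronger w []      φ []      = fstₕ
  force-stronger w []      φ (y ∷ δ) = ⇒-refl _
  force-stronger w (x ∷ α) φ []      = fstₕ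
  force-stronger w (x ∷ α) φ (y ∷ δ) with x ≟ₙ y
  ... | yes refl = force-stronger (child w x) α φ δ
  ... | no _     = ⇒-refl _

  force-at : ∀ w α φ → Hilbert M (force w α φ α ⇒ φ)
  force-at w []      φ = sndₕ
  force-at w (x ∷ α) φ with x ≟ₙ x
  ... | yes refl = force-at (child w x) α φ
  ... | no ¬e    = ⊥-elim (¬e refl)

  force-acc : ∀ w α φ γ y → Hilbert M (w γ ⇒ ◇ w (γ ++ y ∷ [])) →
              Hilbert M (force w α φ γ ⇒ ◇ force w α φ (γ ++ y ∷ []))
  force-acc w []      φ []      y h = h ∘ₕ fstₕ
  force-acc w []      φ (z ∷ γ) y h = h
  force-acc w (x ∷ α) φ []      y h with x ≟ₙ y
  ... | yes refl = sndₕ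
  ... | no _     = h ∘ₕ fstₕ
  force-acc w (x ∷ α) φ (z ∷ γ) y h with x ≟ₙ z
  ... | yes refl = force-acc (child w x) α φ γ y h
  ... | no _     = h

  force-acc-path : ∀ w α φ → AccAlong M (force w α φ) α
  force-acc-path w []      φ {γ} {y} p = ⊥-elim (snoc-⋠-[] γ y p)
  force-acc-path w (x ∷ α) φ {[]} {y} p with x ≟ₙ y
  ... | yes refl = sndₕ
  ... | no ¬e    = ⊥-elim (¬e (sym (proj₁ (⪯-uncons p))))
  force-acc-path w (x ∷ α) φ {z ∷ γ} {y} p with x ≟ₙ z
  ... | yes refl = force-acc-path (child w x) α φ (proj₂ (⪯-uncons p))
  ... | no ¬e    = ⊥-elim (¬e (sym (proj₁ (⪯-uncons p))))

  force-split : ∀ w α φ ψ → AccAlong M w α → Hilbert M (w α ⇒ (φ ∨ ψ)) →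
                Hilbert M (w [] ⇒ (force w α φ [] ∨ force w α ψ []))
  force-split w []      φ ψ a h =
    closed (deduction (∨-elim (thm h · v0) (∨-introˡ (∧-intro v1 v0)) (∨-introʳ (∧-intro v1 v0))))
  force-split w (x ∷ α) φ ψ a h =
    closed (deduction (∨-elim
      (thm ◇-∨ · (thm (◇-mono (force-split (child w x) α φ ψ (acc-subtree (x ∷ []) a) h))
                  · (thm (acc-head a) · v0)))
      (∨-introˡ (∧-intro v1 v0)) (∨-introʳ (∧-intro v1 v0))))

  force-extend : ∀ w α β C → AccAlong M w α → Hilbert M (w α ⇒ force (subtree w α) β C []) →
                 Hilbert M (w [] ⇒ force w (α ++ β) C [])
  force-extend w []      β C a h = h
  force-extend w (x ∷ α) β C a h =
    ⟨ ⇒-refl _ , ◇-mono (force-extend (child w x) α β C (acc-subtree (x ∷ []) a) h) ∘ₕ acc-head a ⟩ₕ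

  refute-split : ∀ {w α φ ψ} → AccAlong M w α → Hilbert M (w α ⇒ (φ ∨ ψ)) →
                 Hilbert M (~ force w α φ []) → Hilbert M (~ force w α ψ []) → Hilbert M (~ w [])
  refute-split {w} {α} {φ} {ψ} a h = tollens-∨ (force-split w α φ ψ a h)

record Good (M : Logic) (w : Labelling) (Γ Δ : Seq) : Set where
  field
    good-ant : ∀ {A α} → (A ^ α) ∈ Γ → Hilbert M (w α ⇒ A)
    good-suc : ∀ {A α} → (A ^ α) ∈ Δ → Hilbert M (w α ⇒ ~ A)
    good-acc : ∀ {γ x} → (γ ++ x ∷ []) ∈I (Γ ++ Δ) → Hilbert M (w γ ⇒ ◇ w (γ ++ x ∷ []))
open Good public

Val : Logic → Seq → Seq → Set
Val M Γ Δ = ∀ w → Good M w Γ Δ → Hilbert M (~ w [])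

module _ {M : Logic} where

  good-empty : ∀ {w} → Good M w [] []
  good-empty .good-ant ()
  good-empty .good-suc ()
  good-empty .good-acc (B , β , () , _)

  good-sub : ∀ {w Γ Γ' Δ Δ'} → Γ' ⊆ Γ → Δ' ⊆ Δ → Good M w Γ Δ → Good M w Γ' Δ'
  good-sub f g G .good-ant m = good-ant G (f m)
  good-sub f g G .good-suc m = good-suc G (g m)
  good-sub f g G .good-acc i = good-acc G (∈I-mono (++⁺ f g) i)

  dropˡ : ∀ {w Γ Δ P} → Good M w (P ∷ Γ) Δ → Good M w Γ Δ
  dropˡ = good-sub there ⊆-refl

  dropʳ : ∀ {w Γ Δ P} → Good M w Γ (P ∷ Δ) → Good M w Γ Δ
  dropʳ = good-sub ⊆-refl there

  acc-∈I : ∀ {w Γ Δ α} → Good M w Γ Δ → α ∈I (Γ ++ Δ) → AccAlong M w α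
  acc-∈I G i p = good-acc G (∈I-⪯ p i)

  acc-principalˡ : ∀ {w Γ Δ A α} → Good M w ((A ^ α) ∷ Γ) Δ → AccAlong M w α
  acc-principalˡ G = acc-∈I G (∈I-pos (here refl))

  acc-principalʳ : ∀ {w Γ Δ A α} → Good M w Γ ((A ^ α) ∷ Δ) → AccAlong M w α
  acc-principalʳ {Γ = Γ} G = acc-∈I G (∈I-pos (∈-++⁺ʳ Γ (here refl)))

  good-consˡ : ∀ {w Γ Δ A α} → Good M w Γ Δ → Hilbert M (w α ⇒ A) → AccAlong M w α →
               Good M w ((A ^ α) ∷ Γ) Δ
  good-consˡ G h a .good-ant (here refl) = h
  good-consˡ G h a .good-ant (there m)   = good-ant G m
  good-consˡ G h a .good-suc m           = good-suc G m
  good-consˡ G h a .good-acc (B , β , here refl , p) = a p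
  good-consˡ G h a .good-acc (B , β , there m , p)   = good-acc G (B , β , m , p)

  good-consʳ : ∀ {w Γ Δ A α} → Good M w Γ Δ → Hilbert M (w α ⇒ ~ A) → AccAlong M w α →
               Good M w Γ ((A ^ α) ∷ Δ)
  good-consʳ G h a .good-ant m           = good-ant G m
  good-consʳ G h a .good-suc (here refl) = h
  good-consʳ G h a .good-suc (there m)   = good-suc G m
  good-consʳ {Γ = Γ} G h a .good-acc (B , β , m , p) with ∈-++⁻ Γ m
  ... | inj₁ m'          = good-acc G (B , β , ∈-++⁺ˡ m' , p)
  ... | inj₂ (here refl) = a p
  ... | inj₂ (there m')  = good-acc G (B , β , ∈-++⁺ʳ Γ m' , p)

  good-force : ∀ {w Γ Δ} α φ → Good M w Γ Δ → Good M (force w α φ) Γ Δ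
  good-force {w} α φ G .good-ant {α = β} m = good-ant G m ∘ₕ force-stronger w α φ β
  good-force {w} α φ G .good-suc {α = β} m = good-suc G m ∘ₕ force-stronger w α φ β
  good-force {w} α φ G .good-acc {γ} {x} i = force-acc w α φ γ x (good-acc G i)

  good-forceˡ : ∀ {w Γ Δ} α A → Good M w Γ Δ → Good M (force w α A) ((A ^ α) ∷ Γ) Δ
  good-forceˡ {w} α A G = good-consˡ (good-force α A G) (force-at w α A) (force-acc-path w α A)

  good-forceʳ : ∀ {w Γ Δ} α A → Good M w Γ Δ → Good M (force w α (~ A)) Γ ((A ^ α) ∷ Δ)
  good-forceʳ {w} α A G = good-consʳ (good-force α (~ A) G) (force-at w α (~ A)) (force-acc-path w α (~ A))

restrict : Seq → Labelling → Labelling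
restrict S w δ with δ ∈I? S
... | yes _ = w δ
... | no _  = Top

restrict-in : ∀ S w δ → δ ∈I S → restrict S w δ ≡ w δ
restrict-in S w δ i with δ ∈I? S
... | yes _ = refl
... | no ¬i = ⊥-elim (¬i i)

restrict-out : ∀ S w δ → ¬ (δ ∈I S) → restrict S w δ ≡ Top
restrict-out S w δ ¬i with δ ∈I? S
... | yes i = ⊥-elim (¬i i)
... | no _  = refl

module _ {M : Logic} where

  restrict-root : ∀ S w → Hilbert M (~ restrict S w []) → Hilbert M (~ w [])
  restrict-root S w h with [] ∈I? S
  ... | yes _ = h
  ... | no _  = closed (explode (thm (⇒-refl _)) (thm h))

  good-restrict : ∀ {w Γ Δ} → Good M w Γ Δ → Good M (restrict (Γ ++ Δ) w) Γ Δ
  good-restrict {w} {Γ} {Δ} G .good-ant {A} {α} m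
    rewrite restrict-in (Γ ++ Δ) w α (∈I-pos (∈-++⁺ˡ m)) = good-ant G m
  good-restrict {w} {Γ} {Δ} G .good-suc {A} {α} m
    rewrite restrict-in (Γ ++ Δ) w α (∈I-pos (∈-++⁺ʳ Γ m)) = good-suc G m
  good-restrict {w} {Γ} {Δ} G .good-acc {γ} {x} i
    rewrite restrict-in (Γ ++ Δ) w (γ ++ x ∷ []) i
          | restrict-in (Γ ++ Δ) w γ (∈I-⪯ (x ∷ [] , refl) i) = good-acc G i

  acc-serial : ∀ {w Γ Δ} → Serial M → Good M w Γ Δ → ∀ γ x →
               Hilbert M (restrict (Γ ++ Δ) w γ ⇒ ◇ restrict (Γ ++ Δ) w (γ ++ x ∷ []))
  acc-serial {w} {Γ} {Δ} s G γ x = by-cases ((γ ++ x ∷ []) ∈I? (Γ ++ Δ))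
    where
    S = Γ ++ Δ
    by-cases : Dec ((γ ++ x ∷ []) ∈I S) → Hilbert M (restrict S w γ ⇒ ◇ restrict S w (γ ++ x ∷ []))
    by-cases (yes i) = good-acc (good-restrict G) i
    by-cases (no ¬i) = subst (λ z → Hilbert M (restrict S w γ ⇒ ◇ z)) (sym (restrict-out S w (γ ++ x ∷ []) ¬i))
                             (closed (deduction (thm (◇-Top s))))

-- The side conditions of cut and of □⊢, ⊢◇ guarantee that the relevant path
-- is accessible: it lies in the tree of the sequent, or the logic is serial.
PathOK : Logic → Position → Seq → Set
PathOK M α S = (α ∈I S) ⊎ Serial M

pathOK-mono : ∀ {M α S S'} → S ⊆ S' → PathOK M α S → PathOK M α S'
pathOK-mono f (inj₁ i) = inj₁ (∈I-mono f i)
pathOK-mono f (inj₂ s) = inj₂ s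

module _ {M : Logic} where

  acc-restrict : ∀ {w Γ Δ α} → Good M w Γ Δ → PathOK M α (Γ ++ Δ) → AccAlong M (restrict (Γ ++ Δ) w) α
  acc-restrict G (inj₁ i) = acc-∈I (good-restrict G) i
  acc-restrict G (inj₂ s) {γ} {x} _ = acc-serial s G γ x

occurs-∈I : ∀ {γ Γ Δ} → Occurs γ Γ Δ → γ ∈I (Γ ++ Δ)
occurs-∈I {γ} {Γ} (B , η , inj₁ m) = B , γ ++ η , ∈-++⁺ˡ m , (η , refl)
occurs-∈I {γ} {Γ} (B , η , inj₂ m) = B , γ ++ η , ∈-++⁺ʳ Γ m , (η , refl)

cut-∈I : ∀ {α} Γ₁ Δ₁ Γ₂ Δ₂ → (α ∈I (Γ₁ ++ Δ₁)) ⊎ (α ∈I (Γ₂ ++ Δ₂)) →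
         α ∈I ((Γ₁ ++ Γ₂) ++ (Δ₁ ++ Δ₂))
cut-∈I Γ₁ Δ₁ Γ₂ Δ₂ (inj₁ i) = ∈I-mono (++⁺ (xs⊆xs++ys Γ₁ Γ₂) (xs⊆xs++ys Δ₁ Δ₂)) i
cut-∈I Γ₁ Δ₁ Γ₂ Δ₂ (inj₂ i) = ∈I-mono (++⁺ (xs⊆ys++xs Γ₂ Γ₁) (xs⊆ys++xs Δ₂ Δ₁)) i

cut-pathOK : ∀ M {α Γ₁ Δ₁ Γ₂ Δ₂} → CutCond M α Γ₁ Δ₁ Γ₂ Δ₂ →
             PathOK M α ((Γ₁ ++ Γ₂) ++ (Δ₁ ++ Δ₂))
cut-pathOK K  {Γ₁ = Γ₁} {Δ₁} {Γ₂} {Δ₂} c = inj₁ (cut-∈I Γ₁ Δ₁ Γ₂ Δ₂ c)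
cut-pathOK K4 {Γ₁ = Γ₁} {Δ₁} {Γ₂} {Δ₂} c = inj₁ (cut-∈I Γ₁ Δ₁ Γ₂ Δ₂ c)
cut-pathOK D  _ = inj₂ serD
cut-pathOK T  _ = inj₂ serT
cut-pathOK S4 _ = inj₂ serS4

box-pathOK : ∀ M {α β Γ Δ} → BoxCond M α β Γ Δ → PathOK M (α ++ β) (Γ ++ Δ)
box-pathOK K  (_ , o) = inj₁ (occurs-∈I o)
box-pathOK K4 (_ , o) = inj₁ (occurs-∈I o)
box-pathOK D  _ = inj₂ serD
box-pathOK T  _ = inj₂ serT
box-pathOK S4 _ = inj₂ serS4

-- The frame conditions behind □⊢: a world X satisfying □C reaches, along
-- an accessible path β of a shape allowed by BoxCond, a world where C holds.
module _ {M : Logic} where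

  box-step : ∀ v y C X → Hilbert M (X ⇒ v []) → Hilbert M (X ⇒ □ C) → AccAlong M v (y ∷ []) →
             Hilbert M (X ⇒ force v (y ∷ []) C [])
  box-step v y C X h₁ h₂ a =
    ⟨ h₁ , closed (deduction (thm □-◇ · (thm h₂ · v0) · (thm (acc-head a) · (thm h₁ · v0)))) ⟩ₕ

  -- With the 4 axiom a box persists along paths of any positive length.
  box-steps : (∀ C → Hilbert M (□ C ⇒ □ (□ C))) →
              ∀ v y β C X → Hilbert M (X ⇒ v []) → Hilbert M (X ⇒ □ C) → AccAlong M v (y ∷ β) →
              Hilbert M (X ⇒ force v (y ∷ β) C [])
  box-steps four v y []      C X h₁ h₂ a = box-step v y C X h₁ h₂ a
  box-steps four v y (z ∷ β) C X h₁ h₂ a =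
    ⟨ h₁ , ◇-mono (box-steps four (child v y) z β C (v (y ∷ []) ∧ (□ C)) fstₕ sndₕ (acc-subtree (y ∷ []) a))
           ∘ₕ closed (deduction (thm □-◇ · (thm (four C) · (thm h₂ · v0))
                                         · (thm (acc-head a) · (thm h₁ · v0)))) ⟩ₕ

-- The cases of BoxCond: one step (K, D, T), zero steps (T, S4) by the T
-- axiom, or several steps (K4, S4) by the 4 axiom.
box-reach : ∀ M {α β Γ Δ} v C X → BoxCond M α β Γ Δ → AccAlong M v β →
            Hilbert M (X ⇒ v []) → Hilbert M (X ⇒ □ C) → Hilbert M (X ⇒ force v β C [])
box-reach K  v C X ((y , refl) , _) a h₁ h₂ = box-step v y C X h₁ h₂ a
box-reach D  v C X (y , refl)       a h₁ h₂ = box-step v y C X h₁ h₂ a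
box-reach T  v C X (inj₁ refl)      a h₁ h₂ = ⟨ h₁ , extra (axT C) ∘ₕ h₂ ⟩ₕ
box-reach T  v C X (inj₂ (y , refl)) a h₁ h₂ = box-step v y C X h₁ h₂ a
box-reach K4 {β = []}    v C X (ne , _) a h₁ h₂ = ⊥-elim (ne refl)
box-reach K4 {β = y ∷ β} v C X _        a h₁ h₂ = box-steps (λ C → extra (ax4 C)) v y β C X h₁ h₂ a
box-reach S4 {β = []}    v C X _ a h₁ h₂ = ⟨ h₁ , extra (axS4T C) ∘ₕ h₂ ⟩ₕ
box-reach S4 {β = y ∷ β} v C X _ a h₁ h₂ = box-steps (λ C → extra (axS44 C)) v y β C X h₁ h₂ a

module _ {M : Logic} where

  box-force : ∀ {w α β Γ Δ Γc Δc C} → BoxCond M α β Γ Δ → (Γ ++ Δ) ⊆ (Γc ++ Δc) →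
              Good M w Γc Δc → Hilbert M (restrict (Γc ++ Δc) w α ⇒ □ C) →
              Hilbert M (restrict (Γc ++ Δc) w [] ⇒ force (restrict (Γc ++ Δc) w) (α ++ β) C [])
  box-force {w} {α} {β} {Γc = Γc} {Δc} {C} bc sub G h =
    force-extend w₀ α β C (acc-prefix (β , refl) acc)
      (box-reach M (subtree w₀ α) C (w₀ α) bc (acc-subtree α acc) (subtree-root w₀ α) h)
    where
    w₀ = restrict (Γc ++ Δc) w
    acc : AccAlong M w₀ (α ++ β)
    acc = acc-restrict G (pathOK-mono sub (box-pathOK M bc))

  -- In a restricted good labelling, ◇C at α forces C at a fresh child α ∘ x,
  -- whose label is ⊤.
  fresh-force : ∀ {w α x Γ Δ C} → ¬ ((α ++ x ∷ []) ∈I (Γ ++ Δ)) → α ∈I (Γ ++ Δ) →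
                Good M w Γ Δ → Hilbert M (restrict (Γ ++ Δ) w α ⇒ ◇ C) →
                Hilbert M (restrict (Γ ++ Δ) w [] ⇒ force (restrict (Γ ++ Δ) w) (α ++ x ∷ []) C [])
  fresh-force {w} {α} {x} {Γ} {Δ} {C} fr i G h =
    force-extend w₀ α (x ∷ []) C (acc-∈I (good-restrict G) i) ⟨ subtree-root w₀ α , witness ⟩ₕ
    where
    w₀ = restrict (Γ ++ Δ) w
    witness : Hilbert M (w₀ α ⇒ ◇ (w₀ (α ++ x ∷ []) ∧ C))
    witness = subst (λ z → Hilbert M (w₀ α ⇒ ◇ (z ∧ C))) (sym (restrict-out (Γ ++ Δ) w (α ++ x ∷ []) fr))
                    (◇-mono (closed (deduction (∧-intro (thm (⇒-refl _)) v0))) ∘ₕ h)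

module _ {M : Logic} where

  cut-valid : ∀ {Γ₁ Δ₁ Γ₂ Δ₂ A α} → CutCond M α Γ₁ Δ₁ Γ₂ Δ₂ →
              Val M Γ₁ ((A ^ α) ∷ Δ₁) → Val M ((A ^ α) ∷ Γ₂) Δ₂ → Val M (Γ₁ ++ Γ₂) (Δ₁ ++ Δ₂)
  cut-valid {Γ₁} {Δ₁} {Γ₂} {Δ₂} {A} {α} cc left right w G =
    restrict-root S w (refute-split (acc-restrict G (cut-pathOK M cc)) excluded-middle
      (left _ (good-forceʳ α A (good-sub (xs⊆xs++ys Γ₁ Γ₂) (xs⊆xs++ys Δ₁ Δ₂) G₀)))
      (right _ (good-forceˡ α A (good-sub (xs⊆ys++xs Γ₂ Γ₁) (xs⊆ys++xs Δ₂ Δ₁) G₀))))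
    where
    S = (Γ₁ ++ Γ₂) ++ (Δ₁ ++ Δ₂)
    G₀ = good-restrict G

  □L-valid : ∀ {Γ Δ A α β} → BoxCond M α β Γ Δ →
             Val M ((A ^ (α ++ β)) ∷ Γ) Δ → Val M (((□ A) ^ α) ∷ Γ) Δ
  □L-valid {Γ} {Δ} {A} {α} {β} bc premise w G =
    restrict-root S w (tollens (box-force bc there G (good-ant G₀ (here refl)))
                               (premise _ (good-forceˡ (α ++ β) A (dropˡ G₀))))
    where
    S = (((□ A) ^ α) ∷ Γ) ++ Δ
    G₀ = good-restrict G

  ◇R-valid : ∀ {Γ Δ A α β} → BoxCond M α β Γ Δ →
             Val M Γ ((A ^ (α ++ β)) ∷ Δ) → Val M Γ (((◇ A) ^ α) ∷ Δ)
  ◇R-valid {Γ} {Δ} {A} {α} {β} bc premise w G =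
    restrict-root S w (tollens (box-force bc (++⁺ ⊆-refl there) G (dneₕ ∘ₕ good-suc G₀ (here refl)))
                               (premise _ (good-forceʳ (α ++ β) A (dropʳ G₀))))
    where
    S = Γ ++ (((◇ A) ^ α) ∷ Δ)
    G₀ = good-restrict G

  □R-valid : ∀ {Γ Δ A α x} → ¬ ((α ++ x ∷ []) ∈I (Γ ++ Δ)) →
             Val M Γ ((A ^ (α ++ x ∷ [])) ∷ Δ) → Val M Γ (((□ A) ^ α) ∷ Δ)
  □R-valid {Γ} {Δ} {A} {α} {x} fr premise w G =
    restrict-root S w (tollens (fresh-force (fresh-insert Γ fr) (∈I-pos (∈-++⁺ʳ Γ (here refl))) G
                                            (¬□-◇¬ ∘ₕ good-suc G₀ (here refl)))
                               (premise _ (good-forceʳ (α ++ x ∷ []) A (dropʳ G₀))))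
    where
    S = Γ ++ (((□ A) ^ α) ∷ Δ)
    G₀ = good-restrict G

  ◇L-valid : ∀ {Γ Δ A α x} → ¬ ((α ++ x ∷ []) ∈I (Γ ++ Δ)) →
             Val M ((A ^ (α ++ x ∷ [])) ∷ Γ) Δ → Val M (((◇ A) ^ α) ∷ Γ) Δ
  ◇L-valid {Γ} {Δ} {A} {α} {x} fr premise w G =
    restrict-root S w (tollens (fresh-force (fresh-insert [] fr) (∈I-pos (here refl)) G (good-ant G₀ (here refl)))
                               (premise _ (good-forceˡ (α ++ x ∷ []) A (dropˡ G₀))))
    where
    S = (((◇ A) ^ α) ∷ Γ) ++ Δ
    G₀ = good-restrict G

-- Structural rules only
-- change the sequent up to inclusion; one-premise propositional rules
-- record the active subformula at the same position; two-premise rules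
-- split the labelling by the disjunction the principal formula implies.
soundness : ∀ {M Γ Δ} → M ⊩ Γ ⊢ Δ → Val M Γ Δ
soundness (axiom {A} {α}) w G =
  refute-root w α (acc-principalˡ G)
    (closed (¬-intro (thm (good-ant G (here refl)) · v0) (thm (good-suc G (here refl)) · v0)))
soundness (cut cc d e) = cut-valid cc (soundness d) (soundness e)
soundness (wkL d) w G  = soundness d w (dropˡ G)
soundness (wkR d) w G  = soundness d w (dropʳ G)
soundness (ctrL d) w G = soundness d w (good-sub (∈-∷⁺ʳ (here refl) ⊆-refl) ⊆-refl G)
soundness (ctrR d) w G = soundness d w (good-sub ⊆-refl (∈-∷⁺ʳ (here refl) ⊆-refl) G)
soundness (exL {Γ₁} {P = P} {Q} d) w G =
  soundness d w (good-sub (⊆-reflexive-↭ (↭-++⁺ˡ Γ₁ (swap P Q ↭-refl))) ⊆-refl G)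
soundness (exR {Δ₁ = Δ₁} {P = P} {Q} d) w G =
  soundness d w (good-sub ⊆-refl (⊆-reflexive-↭ (↭-++⁺ˡ Δ₁ (swap P Q ↭-refl))) G)
soundness (¬L d) w G  = soundness d w (good-consʳ (dropˡ G) (good-ant G (here refl)) (acc-principalˡ G))
soundness (¬R d) w G  = soundness d w (good-consˡ (dropʳ G) (dneₕ ∘ₕ good-suc G (here refl)) (acc-principalʳ G))
soundness (∧L₁ d) w G = soundness d w (good-consˡ (dropˡ G) (fstₕ ∘ₕ good-ant G (here refl)) (acc-principalˡ G))
soundness (∧L₂ d) w G = soundness d w (good-consˡ (dropˡ G) (sndₕ ∘ₕ good-ant G (here refl)) (acc-principalˡ G))
soundness (∨R₁ d) w G =
  soundness d w (good-consʳ (dropʳ G) (¬∨-left ∘ₕ good-suc G (here refl)) (acc-principalʳ G))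
soundness (∨R₂ d) w G =
  soundness d w (good-consʳ (dropʳ G) (¬∨-right ∘ₕ good-suc G (here refl)) (acc-principalʳ G))
soundness (⇒R d) w G  =
  soundness d w (good-consˡ (good-consʳ (dropʳ G) (¬⇒-con ∘ₕ good-suc G (here refl)) (acc-principalʳ G))
                            (¬⇒-ant ∘ₕ good-suc G (here refl)) (acc-principalʳ G))
soundness (∧R {α = α} d e) w G =
  refute-split (acc-principalʳ G) (¬∧-split ∘ₕ good-suc G (here refl))
    (soundness d _ (good-forceʳ α _ (dropʳ G))) (soundness e _ (good-forceʳ α _ (dropʳ G)))
soundness (∨L {α = α} d e) w G =
  refute-split (acc-principalˡ G) (good-ant G (here refl))
    (soundness d _ (good-forceˡ α _ (dropˡ G))) (soundness e _ (good-forceˡ α _ (dropˡ G)))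
soundness (⇒L {α = α} d e) w G =
  refute-split (acc-principalˡ G) (⇒-split ∘ₕ good-ant G (here refl))
    (soundness d _ (good-forceʳ α _ (dropˡ G))) (soundness e _ (good-forceˡ α _ (dropˡ G)))
soundness (□L bc d) = □L-valid bc (soundness d)
soundness (□R fr d) = □R-valid fr (soundness d)
soundness (◇L fr d) = ◇L-valid fr (soundness d)
soundness (◇R bc d) = ◇R-valid bc (soundness d)

-- Refuting ⊤ ∧ ◇(⊤ ∧ … ◇(⊤ ∧ ¬A)) proves A: peel one ◇ at a time with unbox.
refuted-path : ∀ M A α → Hilbert M (~ force (λ _ → Top) α (~ A) []) → Hilbert M A
refuted-path M A []      h = closed (by-contradiction (∧-intro (thm (⇒-refl _)) v0) (thm h))
refuted-path M A (x ∷ α) h =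
  refuted-path M A α (unbox M (closed (dne (¬-intro (∧-intro (thm (⇒-refl _)) v0) (thm h)))))

mainTheorem6 : (M : Logic) (A : Formula) (α : Position) →
    M ⊩ [] ⊢ (A ^ α) ∷ [] → Hilbert M A
mainTheorem6 M A α d =
  refuted-path M A α (soundness d (force (λ _ → Top) α (~ A)) (good-forceʳ α A good-empty))
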